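{- Let $w=\log_2 3$. For every integer $k\ge 0$, $f(k)\le 2^{2^k-wk+3}-6$.
   Context: $\mu$ is the morphism on binary words with $\mu(0)=01$, $\mu(1)=10$; $\mu^n$ is its $n$-fold iterate. Words $CS(k)$, $k\ge 0$, are defined recursively: $CS(0)=0$ (the one-letter word). For $k\ge 1$, let $n=2^k$, $m=2^{k-1}$, $X=\mu^n(0)$, $Y=\mu^n(1)$, and write $X=x_0x_1\cdots x_{2^m-1}$, $Y=y_0y_1\cdots y_{2^m-1}$ as concatenations of $2^m$ consecutive blocks of length $2^m$ (each block is $\mu^m(0)$ or $\mu^m(1)$). For $0\le i<2^m-1$ define $cs_i=x_i$ if $i$ is even; if $i$ is odd, $cs_i=x_i$ when $x_i=y_{i+1}$ and $cs_i=CS(k-1)$ otherwise. Then $CS(k)=cs_0cs_1\cdots cs_{2^m-2}$ (a common subsequence of $\mu^{2^k}(0)$ and $\mu^{2^k}(1)$). Define $f(k)=2^{2^k}-|CS(k)|$. -}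

module Defs where

open import Data.Bool using (Bool; true; false)
import Data.Bool.Properties as BoolP
open import Data.Nat using (ℕ; zero; suc; _*_; _∸_; _^_)
open import Data.List using (List; []; _∷_; [_]; concatMap; take; drop; length; map; upTo; concat)
open import Data.List.Properties using (≡-dec)
open import Data.Integer using (ℤ; +_; _-_)
open import Function using (_∘_)
open import Relation.Nullary using (yes; no)

-- Binary words: lists of Bool, with false = letter 0 and true = letter 1.
Word : Set
Word = List Bool

μ-letter : Bool → Word
μ-letter false = false ∷ true ∷ []
μ-letter true  = true ∷ false ∷ []

μ : Word → Word
μ = concatMap μ-letter

μ^ : ℕ → Word → Word
μ^ zero    w = w
μ^ (suc n) w = μ (μ^ n w)

block : ℕ → Word → ℕ → Word
block L w i = take L (drop (i * L) w)

CS : ℕ → Word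
CS zero    = [ false ]
CS (suc j) = concat (map cs (upTo (2 ^ m ∸ 1)))
  where
  n : ℕ
  n = 2 ^ suc j
  m : ℕ
  m = 2 ^ j
  L : ℕ
  L = 2 ^ m
  X : Word
  X = μ^ n [ false ]
  Y : Word
  Y = μ^ n [ true ]
  x : ℕ → Word
  x = block L X
  y : ℕ → Word
  y = block L Y
  odd-case : ℕ → Word
  odd-case i with ≡-dec BoolP._≟_ (x i) (y (suc i))
  ... | yes _ = x i
  ... | no  _ = CS j
  cs-par : ℕ → ℕ → Word
  cs-par zero          i = x i
  cs-par (suc zero)    i = odd-case i
  cs-par (suc (suc p)) i = cs-par p i
  cs : ℕ → Word
  cs i = cs-par i i

f : ℕ → ℤ
f k = + (2 ^ (2 ^ k)) - + length (CS k)

{-# OPTIONS --safe #-}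
module Submission where

-- Write m = 2^j, L = 2^m and t = μ^m(0). Since μ^(2m) = μ^m ∘ μ^m, the blocks of
-- μ^(2m)(0) and μ^(2m)(1) are x_i = μ^m(t_i) and y_i = μ^m(¬t_i), so an odd factor of
-- CS(j+1) is replaced by CS(j) exactly when t_i = t_(i+1). Hence
-- f(j+1) = L + r_j f(j), where r_j counts the odd positions i with t_i = t_(i+1).
-- As t = μ(μ^(m-1)(0)), r_j is the number of letter changes in μ^(m-1)(0), and the change
-- counts c_p of μ^p(0) satisfy c_p + c_(p+1) = 2^(p+1) - 1, whence 3 r_j ≤ L. For j ≥ 2
-- also 6 ≤ L, and then 3^(j+1) (L + r_j f + 6) ≤ 3^j (3L + 18) + L 3^j f ≤ L 3^j (f + 6),
-- so 3^k (f(k) + 6) ≤ 8 · 2^(2^k) passes from j to j + 1; the cases k ≤ 2 are computed.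

open import Defs
open import Data.Nat using (ℕ; _^_)

module ThueMorseCS where
  open import Data.Bool using (Bool; true; false; not; _xor_)
  import Data.Bool.Properties as Bool
  open import Data.Empty using (⊥-elim)
  open import Data.List
    using (List; []; _∷_; [_]; _++_; length; map; concat; take; drop; upTo; applyUpTo)
  open import Data.Nat.ListAction using (sum)
  open import Data.List.Properties
    using (≡-dec; concatMap-++; length-++; ∷-injectiveˡ; map-∘; map-upTo)
  open import Data.Nat
  open import Data.Nat.Properties
  open import Algebra.Properties.CommutativeSemigroup +-commutativeSemigroup using (xy∙z≈xz∙y)
  open import Data.Nat.Tactic.RingSolver using (solve)
  open import Data.Product using (∃; _,_; proj₁)
  open import Data.Sum using (_⊎_; inj₁; inj₂)
  open import Function using (_∘_)
  import Data.Integer as ℤ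
  import Data.Integer.Properties as ℤ
  open import Relation.Binary.PropositionalEquality
    using (_≡_; _≢_; refl; sym; trans; cong; cong₂; subst; module ≡-Reasoning)
  open import Relation.Nullary using (yes; no)

  bit : Bool → ℕ
  bit false = 0
  bit true  = 1

  -- Junk value: false past the end of the word.
  letter : Word → ℕ → Bool
  letter []      _       = false
  letter (a ∷ w) zero    = a
  letter (a ∷ w) (suc i) = letter w i

  letter-map-not : ∀ w {i} → i < length w → letter (map not w) i ≡ not (letter w i)
  letter-map-not (a ∷ w) {zero}  _         = refl
  letter-map-not (a ∷ w) {suc i} (s≤s i<n) = letter-map-not w i<n

  changes : Word → ℕ
  changes (a ∷ b ∷ w) = bit (a xor b) + changes (b ∷ w)
  changes _           = 0

  -- Positions are counted from 0: the pairs compared are (1,2), (3,4), ...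
  oddRepeats : Word → ℕ
  oddRepeats (_ ∷ b ∷ c ∷ w) = bit (not (b xor c)) + oddRepeats (c ∷ w)
  oddRepeats _               = 0

  take-++ : ∀ {A : Set} (u v : List A) {n} → length u ≡ n → take n (u ++ v) ≡ u
  take-++ []      v refl = refl
  take-++ (a ∷ u) v refl = cong (a ∷_) (take-++ u v refl)

  drop-++ : ∀ {A : Set} (u v : List A) {n} i → length u ≡ n → drop (n + i) (u ++ v) ≡ drop i v
  drop-++ []      v i refl = refl
  drop-++ (a ∷ u) v i refl = drop-++ u v i refl

  length-concat-map : ∀ {A : Set} (f : ℕ → List A) n →
                      length (concat (map f (upTo n))) ≡ sum (applyUpTo (length ∘ f) n)
  length-concat-map f n = trans (length-concat (map f (upTo n)))
                                (cong sum (trans (sym (map-∘ (upTo n))) (map-upTo (length ∘ f) n)))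
    where
    length-concat : ∀ {A : Set} (xss : List (List A)) → length (concat xss) ≡ sum (map length xss)
    length-concat []         = refl
    length-concat (xs ∷ xss) = trans (length-++ xs) (cong (length xs +_) (length-concat xss))

  μ-∷ : ∀ a w → μ (a ∷ w) ≡ a ∷ not a ∷ μ w
  μ-∷ false w = refl
  μ-∷ true  w = refl

  μ-map-not : ∀ w → μ (map not w) ≡ map not (μ w)
  μ-map-not []          = refl
  μ-map-not (false ∷ w) = cong (λ v → true ∷ false ∷ v) (μ-map-not w)
  μ-map-not (true ∷ w)  = cong (λ v → false ∷ true ∷ v) (μ-map-not w)

  length-μ : ∀ w → length (μ w) ≡ 2 * length w
  length-μ []      = refl
  length-μ (a ∷ w) = trans (cong length (μ-∷ a w))
                           (trans (cong (2 +_) (length-μ w)) (sym (*-suc 2 (length w))))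

  μ^-++ : ∀ n u v → μ^ n (u ++ v) ≡ μ^ n u ++ μ^ n v
  μ^-++ zero    u v = refl
  μ^-++ (suc n) u v = trans (cong μ (μ^-++ n u v)) (concatMap-++ μ-letter (μ^ n u) (μ^ n v))

  μ^-+ : ∀ m n w → μ^ (m + n) w ≡ μ^ m (μ^ n w)
  μ^-+ zero    n w = refl
  μ^-+ (suc m) n w = cong μ (μ^-+ m n w)

  μ^-map-not : ∀ n w → μ^ n (map not w) ≡ map not (μ^ n w)
  μ^-map-not zero    w = refl
  μ^-map-not (suc n) w = trans (cong μ (μ^-map-not n w)) (μ-map-not (μ^ n w))

  length-μ^ : ∀ n w → length (μ^ n w) ≡ 2 ^ n * length w
  length-μ^ zero    w = sym (*-identityˡ (length w))
  length-μ^ (suc n) w = trans (length-μ (μ^ n w))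
                              (trans (cong (2 *_) (length-μ^ n w)) (sym (*-assoc 2 (2 ^ n) (length w))))

  length-μ^-[] : ∀ n a → length (μ^ n [ a ]) ≡ 2 ^ n
  length-μ^-[] n a = trans (length-μ^ n [ a ]) (*-identityʳ (2 ^ n))

  μ^-∷ : ∀ n a w → ∃ λ v → μ^ n (a ∷ w) ≡ a ∷ v
  μ^-∷ zero    a w = w , refl
  μ^-∷ (suc n) a w with μ^-∷ n a w
  ... | v , eq = not a ∷ μ v , trans (cong μ eq) (μ-∷ a v)

  μ^-[]-injective : ∀ n {a b} → μ^ n [ a ] ≡ μ^ n [ b ] → a ≡ b
  μ^-[]-injective n {a} {b} eq with μ^-∷ n a [] | μ^-∷ n b []
  ... | _ , eqa | _ , eqb = ∷-injectiveˡ (trans (sym eqa) (trans eq eqb))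

  block-μ^ : ∀ n w {b} → b < length w → block (2 ^ n) (μ^ n w) b ≡ μ^ n [ letter w b ]
  block-μ^ n (a ∷ w) {zero} _ =
    trans (cong (take (2 ^ n)) (μ^-++ n [ a ] w)) (take-++ (μ^ n [ a ]) (μ^ n w) (length-μ^-[] n a))
  block-μ^ n (a ∷ w) {suc b} (s≤s b<n) =
    trans (cong (take (2 ^ n) ∘ drop (2 ^ n + b * 2 ^ n)) (μ^-++ n [ a ] w))
          (trans (cong (take (2 ^ n)) (drop-++ (μ^ n [ a ]) (μ^ n w) (b * 2 ^ n) (length-μ^-[] n a)))
                 (block-μ^ n w b<n))

  thueMorse : ℕ → Word
  thueMorse m = μ^ m [ false ]

  block-μ^-double : ∀ m c {b} → b < 2 ^ m →
                    block (2 ^ m) (μ^ (2 * m) [ c ]) b ≡ μ^ m [ letter (μ^ m [ c ]) b ]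
  block-μ^-double m c {b} b<2^m = begin
      block (2 ^ m) (μ^ (2 * m) [ c ]) b
    ≡⟨ cong (λ n → block (2 ^ m) (μ^ (m + n) [ c ]) b) (+-identityʳ m) ⟩
      block (2 ^ m) (μ^ (m + m) [ c ]) b
    ≡⟨ cong (λ w → block (2 ^ m) w b) (μ^-+ m m [ c ]) ⟩
      block (2 ^ m) (μ^ m (μ^ m [ c ])) b
    ≡⟨ block-μ^ m (μ^ m [ c ]) (subst (b <_) (sym (length-μ^-[] m c)) b<2^m) ⟩
      μ^ m [ letter (μ^ m [ c ]) b ]
    ∎
    where open ≡-Reasoning

  μ-oddRepeats : ∀ w → oddRepeats (μ w) ≡ changes w
  μ-oddRepeats []                  = refl
  μ-oddRepeats (false ∷ [])        = refl
  μ-oddRepeats (true ∷ [])         = refl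
  μ-oddRepeats (false ∷ false ∷ w) = μ-oddRepeats (false ∷ w)
  μ-oddRepeats (false ∷ true ∷ w)  = cong suc (μ-oddRepeats (true ∷ w))
  μ-oddRepeats (true ∷ false ∷ w)  = cong suc (μ-oddRepeats (false ∷ w))
  μ-oddRepeats (true ∷ true ∷ w)   = μ-oddRepeats (true ∷ w)

  changes-μ : ∀ a w → suc (changes (μ (a ∷ w)) + changes (a ∷ w)) ≡ length (μ (a ∷ w))
  changes-μ false []          = refl
  changes-μ true  []          = refl
  changes-μ false (false ∷ w) = cong (suc ∘ suc) (changes-μ false w)
  changes-μ true  (true ∷ w)  = cong (suc ∘ suc) (changes-μ true w)
  changes-μ false (true ∷ w)  =
    cong (suc ∘ suc) (trans (+-suc (changes (μ (true ∷ w))) (changes (true ∷ w))) (changes-μ true w))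
  changes-μ true  (false ∷ w) =
    cong (suc ∘ suc) (trans (+-suc (changes (μ (false ∷ w))) (changes (false ∷ w))) (changes-μ false w))

  changes-thueMorse : ∀ p → suc (changes (thueMorse (suc p)) + changes (thueMorse p)) ≡ 2 ^ suc p
  changes-thueMorse p with μ^-∷ p false []
  ... | v , tm≡ = begin
      suc (changes (μ (thueMorse p)) + changes (thueMorse p))
    ≡⟨ cong (λ w → suc (changes (μ w) + changes w)) tm≡ ⟩
      suc (changes (μ (false ∷ v)) + changes (false ∷ v))
    ≡⟨ changes-μ false v ⟩
      length (μ (false ∷ v))
    ≡⟨ cong (length ∘ μ) (sym tm≡) ⟩
      length (thueMorse (suc p))
    ≡⟨ length-μ^-[] (suc p) false ⟩
      2 ^ suc p
    ∎
    where open ≡-Reasoning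

  residue-swap : ∀ {A c c′} r s → r + s ≡ 3 → suc (c′ + c) ≡ A →
                 3 * c + r ≡ A → 3 * c′ + s ≡ 2 * A
  residue-swap {A} {c} {c′} r s r+s≡3 c′+c≡A 3c+r≡A = +-cancelʳ-≡ (3 * c + r) _ _ (begin
      (3 * c′ + s) + (3 * c + r)  ≡⟨ solve (c′ ∷ s ∷ c ∷ r ∷ []) ⟩
      3 * (c′ + c) + (r + s)      ≡⟨ cong (3 * (c′ + c) +_) r+s≡3 ⟩
      3 * (c′ + c) + 3            ≡⟨ solve (c′ ∷ c ∷ []) ⟩
      3 * suc (c′ + c)            ≡⟨ cong (3 *_) c′+c≡A ⟩
      3 * A                       ≡⟨ solve (A ∷ []) ⟩
      2 * A + A                   ≡⟨ cong (2 * A +_) (sym 3c+r≡A) ⟩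
      2 * A + (3 * c + r)         ∎)
    where open ≡-Reasoning

  changes-thueMorse-mod3 : ∀ p → 3 * changes (thueMorse p) + 1 ≡ 2 ^ suc p
                               ⊎ 3 * changes (thueMorse p) + 2 ≡ 2 ^ suc p
  changes-thueMorse-mod3 zero = inj₂ refl
  changes-thueMorse-mod3 (suc p) with changes-thueMorse-mod3 p
  ... | inj₁ eq = inj₂ (residue-swap {c = changes (thueMorse p)} 1 2 refl (changes-thueMorse p) eq)
  ... | inj₂ eq = inj₁ (residue-swap {c = changes (thueMorse p)} 2 1 refl (changes-thueMorse p) eq)

  oddRepeats-thueMorse : ∀ m → 3 * oddRepeats (thueMorse m) ≤ 2 ^ m
  oddRepeats-thueMorse zero    = z≤n
  oddRepeats-thueMorse (suc p) rewrite μ-oddRepeats (thueMorse p) with changes-thueMorse-mod3 p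
  ... | inj₁ eq = subst (3 * changes (thueMorse p) ≤_) eq (m≤m+n _ 1)
  ... | inj₂ eq = subst (3 * changes (thueMorse p) ≤_) eq (m≤m+n _ 2)

  double : ℕ → ℕ
  double zero    = zero
  double (suc n) = suc (suc (double n))

  repeatAt : Word → ℕ → ℕ
  repeatAt w i = bit (not (letter w i xor letter w (suc i)))

  sum-factors : ∀ {L l} (t : Word) (g : ℕ → ℕ) →
                (∀ s → double s < length t → g (double s) ≡ L) →
                (∀ s → suc (suc (double s)) < length t →
                   let r = repeatAt t (suc (double s)) in g (suc (double s)) + r * L ≡ L + r * l) →
                let n = length t ∸ 1 in
                sum (applyUpTo g n) + oddRepeats t * L ≡ n * L + oddRepeats t * l
  sum-factors []           g even odd = refl
  sum-factors (_ ∷ [])     g even odd = refl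
  sum-factors (_ ∷ _ ∷ []) g even odd = cong (λ n → n + 0 + 0) (even 0 (s≤s z≤n))
  sum-factors {L} {l} (_ ∷ b ∷ t@(c ∷ w)) g even odd = begin
      (g 0 + (g 1 + rest)) + (r + R) * L
    ≡⟨ regroup (g 0) (g 1) rest r R ⟩
      g 0 + ((g 1 + r * L) + (rest + R * L))
    ≡⟨ cong₂ _+_ (even 0 (s≤s z≤n)) (cong₂ _+_ (odd 0 (s≤s (s≤s (s≤s z≤n))))
         (sum-factors t g″ (λ s lt → even (suc s) (s≤s (s≤s lt)))
                           (λ s lt → odd (suc s) (s≤s (s≤s lt))))) ⟩
      L + ((L + r * l) + (length w * L + R * l))
    ≡⟨ collect r (length w) R ⟩
      suc (suc (length w)) * L + (r + R) * l
    ∎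
    where
    open ≡-Reasoning
    g″ : ℕ → ℕ
    g″ = g ∘ suc ∘ suc
    rest r R : ℕ
    rest = sum (applyUpTo g″ (length w))
    r = bit (not (b xor c))
    R = oddRepeats t
    regroup : ∀ x y z u v → (x + (y + z)) + (u + v) * L ≡ x + ((y + u * L) + (z + v * L))
    regroup x y z u v = solve (x ∷ y ∷ z ∷ u ∷ v ∷ L ∷ [])
    collect : ∀ u n v → L + ((L + u * l) + (n * L + v * l)) ≡ suc (suc n) * L + (u + v) * l
    collect u n v = solve (L ∷ u ∷ l ∷ n ∷ v ∷ [])

  -- The factors cs_i of CS (suc j) and the parity recursion computing them are local to the
  -- definition of CS; they are recovered here by unification (the with-abstraction turns the
  -- second argument into a variable so that the recursion is solved for as a function).
  CS-suc-factors : ∀ j → ∃ λ (cs : ℕ → Word) →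
                   CS (suc j) ≡ concat (map cs (upTo (2 ^ 2 ^ j ∸ 1)))
  CS-suc-factors j = _ , refl

  factor : ℕ → ℕ → Word
  factor j = proj₁ (CS-suc-factors j)

  factor-parity : ∀ j → ∃ λ (byParity : ℕ → ℕ → Word) →
                  ∀ p → factor j (suc (suc p)) ≡ byParity p (suc (suc p))
  factor-parity j = byParity , unfold
    where
    byParity : ℕ → ℕ → Word
    byParity = _
    unfold : ∀ p → factor j (suc (suc p)) ≡ byParity p (suc (suc p))
    unfold p with suc (suc p)
    ... | _ = refl

  factorByParity : ℕ → ℕ → ℕ → Word
  factorByParity j = proj₁ (factor-parity j)

  xBlock yBlock : ℕ → ℕ → Word
  xBlock j = block (2 ^ 2 ^ j) (μ^ (2 ^ suc j) [ false ])
  yBlock j = block (2 ^ 2 ^ j) (μ^ (2 ^ suc j) [ true ])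

  factorByParity-even : ∀ j s b → factorByParity j (double s) b ≡ xBlock j b
  factorByParity-even j zero    b = refl
  factorByParity-even j (suc s) b = factorByParity-even j s b

  factorByParity-odd : ∀ j s b → factorByParity j (suc (double s)) b ≡ factorByParity j 1 b
  factorByParity-odd j zero    b = refl
  factorByParity-odd j (suc s) b = factorByParity-odd j s b

  factorByParity-1-≡ : ∀ j b → xBlock j b ≡ yBlock j (suc b) → factorByParity j 1 b ≡ xBlock j b
  factorByParity-1-≡ j b x≡y with ≡-dec Bool._≟_ (xBlock j b) (yBlock j (suc b))
  ... | yes _   = refl
  ... | no  x≢y = ⊥-elim (x≢y x≡y)

  factorByParity-1-≢ : ∀ j b → xBlock j b ≢ yBlock j (suc b) → factorByParity j 1 b ≡ CS j
  factorByParity-1-≢ j b x≢y with ≡-dec Bool._≟_ (xBlock j b) (yBlock j (suc b))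
  ... | yes x≡y = ⊥-elim (x≢y x≡y)
  ... | no  _   = refl

  xBlock-letter : ∀ j {b} → b < 2 ^ 2 ^ j →
                  xBlock j b ≡ μ^ (2 ^ j) [ letter (thueMorse (2 ^ j)) b ]
  xBlock-letter j = block-μ^-double (2 ^ j) false

  yBlock-letter : ∀ j {b} → b < 2 ^ 2 ^ j →
                  yBlock j b ≡ μ^ (2 ^ j) [ not (letter (thueMorse (2 ^ j)) b) ]
  yBlock-letter j {b} b<L = trans (block-μ^-double (2 ^ j) true b<L) (cong (λ a → μ^ (2 ^ j) [ a ]) (begin
      letter (μ^ (2 ^ j) (map not [ false ])) b
    ≡⟨ cong (λ w → letter w b) (μ^-map-not (2 ^ j) [ false ]) ⟩
      letter (map not (thueMorse (2 ^ j))) b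
    ≡⟨ letter-map-not (thueMorse (2 ^ j)) b<|t| ⟩
      not (letter (thueMorse (2 ^ j)) b)
    ∎))
    where
    open ≡-Reasoning
    b<|t| : b < length (thueMorse (2 ^ j))
    b<|t| = subst (b <_) (sym (length-μ^-[] (2 ^ j) false)) b<L

  length-factor-even : ∀ j s → double s < 2 ^ 2 ^ j → length (factor j (double s)) ≡ 2 ^ 2 ^ j
  length-factor-even j s lt =
    trans (cong length (trans (factorByParity-even j s (double s)) (xBlock-letter j lt)))
          (length-μ^-[] (2 ^ j) _)

  length-factorByParity-1 : ∀ j {b} → suc b < 2 ^ 2 ^ j →
                            let L = 2 ^ 2 ^ j ; r = repeatAt (thueMorse (2 ^ j)) b in
                            length (factorByParity j 1 b) + r * L ≡ L + r * length (CS j)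
  length-factorByParity-1 j {b} sb<L = byLetters (letter t b) (letter t (suc b)) refl (yBlock-letter j sb<L)
    where
    t : Word
    t = thueMorse (2 ^ j)
    L l : ℕ
    L = 2 ^ 2 ^ j
    l = length (CS j)
    x≡ : xBlock j b ≡ μ^ (2 ^ j) [ letter t b ]
    x≡ = xBlock-letter j (<-trans (n<1+n b) sb<L)
    alternating : ∀ {u} → letter t b ≡ u → yBlock j (suc b) ≡ μ^ (2 ^ j) [ u ] →
                  length (factorByParity j 1 b) + 0 * L ≡ L + 0 * l
    alternating refl y≡ = cong (_+ 0) (begin
      length (factorByParity j 1 b)       ≡⟨ cong length (factorByParity-1-≡ j b (trans x≡ (sym y≡))) ⟩
      length (xBlock j b)                 ≡⟨ cong length x≡ ⟩
      length (μ^ (2 ^ j) [ letter t b ])  ≡⟨ length-μ^-[] (2 ^ j) _ ⟩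
      L                                   ∎)
      where open ≡-Reasoning
    repeated : ∀ {u} → letter t b ≡ u → yBlock j (suc b) ≡ μ^ (2 ^ j) [ not u ] →
               length (factorByParity j 1 b) + 1 * L ≡ L + 1 * l
    repeated refl y≡ = begin
      length (factorByParity j 1 b) + 1 * L  ≡⟨ cong (λ w → length w + 1 * L) (factorByParity-1-≢ j b x≢y) ⟩
      l + 1 * L                              ≡⟨ +-comm l (1 * L) ⟩
      1 * L + l                              ≡⟨ cong₂ _+_ (*-identityˡ L) (sym (*-identityˡ l)) ⟩
      L + 1 * l                              ∎
      where
      open ≡-Reasoning
      x≢y : xBlock j b ≢ yBlock j (suc b)
      x≢y x≡y = Bool.not-¬ refl (μ^-[]-injective (2 ^ j) (trans (sym x≡) (trans x≡y y≡)))
    byLetters : ∀ u v → letter t b ≡ u → yBlock j (suc b) ≡ μ^ (2 ^ j) [ not v ] →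
                length (factorByParity j 1 b) + bit (not (u xor v)) * L ≡ L + bit (not (u xor v)) * l
    byLetters false false = repeated
    byLetters true  true  = repeated
    byLetters false true  = alternating
    byLetters true  false = alternating

  length-CS-suc : ∀ j → let L = 2 ^ 2 ^ j ; r = oddRepeats (thueMorse (2 ^ j)) in
                  length (CS (suc j)) + r * L ≡ (L ∸ 1) * L + r * length (CS j)
  length-CS-suc j = begin
      length (CS (suc j)) + r * L
    ≡⟨ cong (_+ r * L) (length-concat-map (factor j) (L ∸ 1)) ⟩
      sum (applyUpTo g (L ∸ 1)) + r * L
    ≡⟨ cong (λ n → sum (applyUpTo g (n ∸ 1)) + r * L) (sym |t|≡L) ⟩
      sum (applyUpTo g (length t ∸ 1)) + r * L
    ≡⟨ sum-factors t g (λ s lt → length-factor-even j s (<-|t| lt)) odd ⟩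
      (length t ∸ 1) * L + r * length (CS j)
    ≡⟨ cong (λ n → (n ∸ 1) * L + r * length (CS j)) |t|≡L ⟩
      (L ∸ 1) * L + r * length (CS j)
    ∎
    where
    open ≡-Reasoning
    t : Word
    t = thueMorse (2 ^ j)
    L r : ℕ
    L = 2 ^ 2 ^ j
    r = oddRepeats t
    g : ℕ → ℕ
    g = length ∘ factor j
    |t|≡L : length t ≡ L
    |t|≡L = length-μ^-[] (2 ^ j) false
    <-|t| : ∀ {i} → i < length t → i < L
    <-|t| = subst (_ <_) |t|≡L
    odd : ∀ s → suc (suc (double s)) < length t →
          let r′ = repeatAt t (suc (double s)) in g (suc (double s)) + r′ * L ≡ L + r′ * length (CS j)
    odd s lt = trans (cong (λ w → length w + repeatAt t (suc (double s)) * L) (factorByParity-odd j s _))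
                     (length-factorByParity-1 j (<-|t| lt))

  defect : ℕ → ℕ
  defect zero    = 1
  defect (suc j) = 2 ^ 2 ^ j + oddRepeats (thueMorse (2 ^ j)) * defect j

  ^-double : ∀ a m → a ^ (2 * m) ≡ a ^ m * a ^ m
  ^-double a m = trans (cong (λ n → a ^ (m + n)) (+-identityʳ m)) (^-distribˡ-+-* a m m)

  [n∸1]*n+n≡n*n : ∀ n → 1 ≤ n → (n ∸ 1) * n + n ≡ n * n
  [n∸1]*n+n≡n*n n 1≤n = trans (cong ((n ∸ 1) * n +_) (sym (*-identityˡ n)))
                       (trans (sym (*-distribʳ-+ n (n ∸ 1) 1)) (cong (_* n) (m∸n+n≡m 1≤n)))

  length-CS+defect : ∀ k → length (CS k) + defect k ≡ 2 ^ 2 ^ k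
  length-CS+defect zero    = refl
  length-CS+defect (suc j) = trans (+-cancelʳ-≡ (r * l) _ _ (begin
      (l′ + (L + r * d)) + r * l  ≡⟨ shift l′ L r d l ⟩
      (l′ + r * (l + d)) + L      ≡⟨ cong (λ n → l′ + r * n + L) (length-CS+defect j) ⟩
      (l′ + r * L) + L            ≡⟨ cong (_+ L) (length-CS-suc j) ⟩
      ((L ∸ 1) * L + r * l) + L   ≡⟨ xy∙z≈xz∙y ((L ∸ 1) * L) (r * l) L ⟩
      ((L ∸ 1) * L + L) + r * l   ≡⟨ cong (_+ r * l) ([n∸1]*n+n≡n*n L (m^n>0 2 (2 ^ j))) ⟩
      L * L + r * l               ∎))
    (sym (^-double 2 (2 ^ j)))
    where
    open ≡-Reasoning
    L r l l′ d : ℕ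
    L = 2 ^ 2 ^ j
    r = oddRepeats (thueMorse (2 ^ j))
    l = length (CS j)
    l′ = length (CS (suc j))
    d = defect j
    shift : ∀ c L r d l → (c + (L + r * d)) + r * l ≡ (c + r * (l + d)) + L
    shift c L r d l = solve (c ∷ L ∷ r ∷ d ∷ l ∷ [])

  defect-step : ∀ q r d {L} → 3 * r ≤ L → 6 ≤ L → q * (d + 6) ≤ 8 * L →
                3 * q * (L + r * d + 6) ≤ 8 * (L * L)
  defect-step q r d {L} 3r≤L 6≤L ih = begin
      3 * q * (L + r * d + 6)
    ≡⟨ solve (q ∷ r ∷ d ∷ L ∷ []) ⟩
      (3 * r) * (q * d) + q * (3 * L + 18)
    ≤⟨ +-mono-≤ (*-monoˡ-≤ (q * d) 3r≤L) (*-monoʳ-≤ q 3L+18≤6L) ⟩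
      L * (q * d) + q * (6 * L)
    ≡⟨ solve (q ∷ d ∷ L ∷ []) ⟩
      L * (q * (d + 6))
    ≤⟨ *-monoʳ-≤ L ih ⟩
      L * (8 * L)
    ≡⟨ solve (L ∷ []) ⟩
      8 * (L * L)
    ∎
    where
    open ≤-Reasoning
    3L+18≤6L : 3 * L + 18 ≤ 6 * L
    3L+18≤6L = begin
      3 * L + 18     ≤⟨ +-monoʳ-≤ (3 * L) (*-monoʳ-≤ 3 6≤L) ⟩
      3 * L + 3 * L  ≡⟨ solve (L ∷ []) ⟩
      6 * L          ∎

  defect-bound : ∀ k → 3 ^ k * (defect k + 6) ≤ 8 * 2 ^ 2 ^ k
  defect-bound 0 = ≤ᵇ⇒≤ _ _ _
  defect-bound 1 = ≤ᵇ⇒≤ _ _ _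
  defect-bound 2 = ≤ᵇ⇒≤ _ _ _
  defect-bound (suc j@(suc (suc _))) =
    subst (λ n → 3 ^ suc j * (defect (suc j) + 6) ≤ 8 * n) (sym (^-double 2 (2 ^ j)))
          (defect-step (3 ^ j) (oddRepeats (thueMorse (2 ^ j))) (defect j)
                       (oddRepeats-thueMorse (2 ^ j)) 6≤L (defect-bound j))
    where
    6≤L : 6 ≤ 2 ^ 2 ^ j
    6≤L = ≤-trans (≤ᵇ⇒≤ 6 16 _) (^-monoʳ-≤ 2 (^-monoʳ-≤ 2 {2} {j} (s≤s (s≤s z≤n))))

  f≡defect : ∀ k → f k ≡ ℤ.+ defect k
  f≡defect k = begin
      ℤ.+ (2 ^ 2 ^ k) ℤ.- ℤ.+ l       ≡⟨ cong (λ n → ℤ.+ n ℤ.- ℤ.+ l) (sym (length-CS+defect k)) ⟩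
      ℤ.+ (l + d) ℤ.- ℤ.+ l           ≡⟨ ℤ.[+m]-[+n]≡m⊖n (l + d) l ⟩
      (l + d) ℤ.⊖ l                   ≡⟨ ℤ.⊖-≥ (m≤m+n l d) ⟩
      ℤ.+ (l + d ∸ l)                 ≡⟨ cong ℤ.+_ (m+n∸m≡n l d) ⟩
      ℤ.+ d                           ∎
    where
    open ≡-Reasoning
    l d : ℕ
    l = length (CS k)
    d = defect k

open ThueMorseCS using (f≡defect; defect-bound)
open import Data.Integer using (+_; _+_; _*_; _≤_; +≤+)
open import Data.Integer.Properties using (pos-*)
open import Relation.Binary.PropositionalEquality using (subst)

theorem4 : (k : ℕ) → + (3 ^ k) * (f k + + 6) ≤ + (8 Data.Nat.* 2 ^ (2 ^ k))
theorem4 k rewrite f≡defect k =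
  subst (_≤ + (8 Data.Nat.* 2 ^ (2 ^ k))) (pos-* (3 ^ k) _) (+≤+ (defect-bound k))
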